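{- Let $r$ be an odd positive integer and let $m=\frac{3}{2}(r+1)$. Then the chain graphs with binary strings $b_1=0\,1^{m}0^{m}1^{2m+r}$ and $b_2=0\,1^{2m}0^{2m}1^{r}$ (both on $4m+r+1$ vertices) are Seidel cospectral, i.e. their Seidel matrices have the same multiset of eigenvalues.
   Context: For a binary string $b=0^{s_1}1^{t_1}\cdots 0^{s_k}1^{t_k}$ with all $s_i,t_i\ge 1$ ($x^p$ denotes the symbol $x$ repeated $p$ times), the chain graph with binary string $b$ is the graph obtained by reading $b$ left to right and adding one vertex per symbol: a $0$-vertex is added with no edges, and a $1$-vertex is added adjacent to all previously added $0$-vertices and to nothing else. For a graph with adjacency matrix $A$ of order $n$, its Seidel matrix is $S=J-I-2A$, where $J$ is the all-ones $n\times n$ matrix and $I$ the identity; i.e. $S_{ij}=-1$ if $v_i\sim v_j$, $S_{ij}=1$ if $i\ne j$ and $v_i\not\sim v_j$, and $S_{ii}=0$. -}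

module Defs where

open import Data.Bool using (Bool; true; false; if_then_else_)
open import Data.Nat using (ℕ; zero; suc; _<ᵇ_)
open import Data.Fin using (Fin; zero; suc; toℕ; punchIn; _≟_)
open import Data.List using (List; []; _∷_; _++_; replicate; length; lookup; map)
open import Data.Integer using (ℤ; 0ℤ; 1ℤ; -1ℤ; -_) renaming (_+_ to _+ℤ_; _*_ to _*ℤ_)
open import Relation.Nullary using (yes; no)
open import Relation.Binary.PropositionalEquality using (_≡_)

-- A binary string; false = symbol 0, true = symbol 1.
BinString : Set
BinString = List Bool

order : BinString → ℕ
order = length

-- Adjacency of the chain graph with binary string b: vertex i is the
-- i-th symbol.  A 1-vertex is adjacent exactly to the 0-vertices added
-- before it.
adjacent : (b : BinString) → Fin (order b) → Fin (order b) → Bool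
adjacent b i j with lookup b i | lookup b j
... | false | true  = toℕ i <ᵇ toℕ j
... | true  | false = toℕ j <ᵇ toℕ i
... | _     | _     = false

Matrix : ℕ → Set
Matrix n = Fin n → Fin n → ℤ

-- Seidel matrix S = J - I - 2A.
seidel : (b : BinString) → Matrix (order b)
seidel b i j with i ≟ j
... | yes _ = 0ℤ
... | no  _ = if adjacent b i j then -1ℤ else 1ℤ

-- Polynomials over ℤ as coefficient lists (lowest degree first).

Poly : Set
Poly = List ℤ

infixl 6 _+P_
infixl 7 _*P_

_+P_ : Poly → Poly → Poly
[]      +P q       = q
(a ∷ p) +P []      = a ∷ p
(a ∷ p) +P (c ∷ q) = (a +ℤ c) ∷ (p +P q)

scaleP : ℤ → Poly → Poly
scaleP a = map (a *ℤ_)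

_*P_ : Poly → Poly → Poly
[]      *P q = []
(a ∷ p) *P q = scaleP a q +P (0ℤ ∷ (p *P q))

constP : ℤ → Poly
constP a = a ∷ []

varP : Poly
varP = 0ℤ ∷ 1ℤ ∷ []

coeff : Poly → ℕ → ℤ
coeff []      k       = 0ℤ
coeff (a ∷ p) zero    = a
coeff (a ∷ p) (suc k) = coeff p k

sign : ℕ → ℤ
sign zero          = 1ℤ
sign (suc zero)    = -1ℤ
sign (suc (suc k)) = sign k

sumP : (n : ℕ) → (Fin n → Poly) → Poly
sumP zero    f = []
sumP (suc n) f = f zero +P sumP n (λ j → f (suc j))

det : (n : ℕ) → (Fin n → Fin n → Poly) → Poly
det zero    M = constP 1ℤ
det (suc n) M =
  sumP (suc n) (λ j →
    constP (sign (toℕ j)) *P M zero j *P det n (λ i k → M (suc i) (punchIn j k)))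

charPoly : (n : ℕ) → Matrix n → Poly
charPoly n S = det n (λ i j → entry i j)
  where
  entry : Fin n → Fin n → Poly
  entry i j with i ≟ j
  ... | yes _ = varP +P constP (- S i j)
  ... | no  _ = constP (- S i j)

-- Two (symmetric integer) matrices are cospectral iff they have the same
-- multiset of eigenvalues, i.e. the same characteristic polynomial.
Cospectral : {n₁ n₂ : ℕ} → Matrix n₁ → Matrix n₂ → Set
Cospectral {n₁} {n₂} S₁ S₂ = ∀ k → coeff (charPoly n₁ S₁) k ≡ coeff (charPoly n₂ S₂) k

SeidelCospectral : BinString → BinString → Set
SeidelCospectral b₁ b₂ = Cospectral (seidel b₁) (seidel b₂)

zeros ones : ℕ → BinString
zeros s = replicate s false
ones  t = replicate t true

{-# OPTIONS --safe #-}
module Submission where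

-- Two consecutive equal symbols of a binary string give twin vertices: in
-- xI - S their columns agree outside the 2 × 2 block they span, and each
-- diagonal entry exceeds the entry beside it by y = x + 1.  Subtracting one
-- twin column from the other and expanding twice gives
--   χ(u x x v) = 2y χ(u x v) - y² χ(u v).
-- So the Seidel characteristic polynomial of 0 1^b 0^c 1^d satisfies this
-- recurrence in each of b, c and d.  Its solutions are spanned by y^n and
-- n y^(n-1), so the polynomial is a fixed multi-affine expression in these,
-- pinned down by the eight strings with b, c, d ∈ {0, 1}.  With r = 1 + 2s
-- and m = 3 + 3s both strings of the theorem give polynomials in y, s and
-- y^s, and these two polynomials coincide.

open import Defs
open import Function using (_∘_)
open import Data.Bool using (Bool; true; false; if_then_else_)
open import Data.Empty using (⊥-elim)
open import Data.Fin using (Fin; zero; suc; toℕ; punchIn; inject₁; fromℕ<; _≟_)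
open import Data.Fin.Properties using (punchInᵢ≢i; punchIn-injective; toℕ-inject₁; toℕ-injective; toℕ-fromℕ<)
open import Data.Integer as ℤ using (0ℤ; 1ℤ; -1ℤ; -_)
import Data.Integer.Properties as ℤ
open import Data.List using ([]; _∷_; _++_; length; lookup)
open import Data.List.Properties using (length-++; ++-assoc)
open import Data.Maybe as Maybe using (Maybe; just; nothing; from-just; From-just)
open import Data.Nat using (ℕ; zero; suc; _+_; _*_; _%_; _/_; _≡ᵇ_; _<ᵇ_; s≤s)
import Data.Nat.Properties as ℕ
import Data.Nat.Tactic.RingSolver as NatSolver
open import Data.Nat.DivMod using (m≡m%n+[m/n]*n)
open import Data.Product using (_×_; _,_; proj₁; ∃-syntax)
open import Data.Sum using (_⊎_; inj₁; inj₂)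
open import Relation.Nullary using (Dec; yes; no)
open import Relation.Binary.PropositionalEquality using (_≡_; _≢_; refl; cong; cong₂; sym; trans; ≢-sym; module ≡-Reasoning)
open import Relation.Binary.Bundles using (Setoid)
open import Algebra.Bundles using (AbelianGroup; CommutativeRing)
open import Algebra.Bundles.Raw using (RawRing)
open import Algebra.Structures using (IsAbelianGroup)
open import Tactic.RingSolver using (solve-∀)
open import Tactic.RingSolver.Core.AlmostCommutativeRing using (AlmostCommutativeRing; fromCommutativeRing)
open import Tactic.RingSolver.Core.Expression as Expr using (Expr)

-- Polynomials over ℤ

-- A record rather than a function type, so that p and q can be inferred
-- from a proof of p ≈ q.
infix 4 _≈_
record _≈_ (p q : Poly) : Set where
  constructor coeffwise
  field coeff-≡ : ∀ k → coeff p k ≡ coeff q k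
open _≈_

0P 1P : Poly
0P = []
1P = constP 1ℤ

infix 8 -P_
-P_ : Poly → Poly
-P p = scaleP -1ℤ p

coeff-+P : ∀ p q k → coeff (p +P q) k ≡ coeff p k ℤ.+ coeff q k
coeff-+P []      q       k       = sym (ℤ.+-identityˡ _)
coeff-+P (a ∷ p) []      k       = sym (ℤ.+-identityʳ _)
coeff-+P (a ∷ p) (b ∷ q) zero    = refl
coeff-+P (a ∷ p) (b ∷ q) (suc k) = coeff-+P p q k

coeff-scaleP : ∀ a p k → coeff (scaleP a p) k ≡ a ℤ.* coeff p k
coeff-scaleP a []      k       = sym (ℤ.*-zeroʳ a)
coeff-scaleP a (b ∷ p) zero    = refl
coeff-scaleP a (b ∷ p) (suc k) = coeff-scaleP a p k

≈-refl : ∀ {p} → p ≈ p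
≈-refl = coeffwise λ _ → refl

≈-sym : ∀ {p q} → p ≈ q → q ≈ p
≈-sym p≈q = coeffwise λ k → sym (coeff-≡ p≈q k)

≈-trans : ∀ {p q r} → p ≈ q → q ≈ r → p ≈ r
≈-trans p≈q q≈r = coeffwise λ k → trans (coeff-≡ p≈q k) (coeff-≡ q≈r k)

≈-reflexive : ∀ {p q} → p ≡ q → p ≈ q
≈-reflexive refl = ≈-refl

[]≈0∷[] : 0P ≈ 0ℤ ∷ []
[]≈0∷[] = coeffwise λ { zero → refl ; (suc k) → refl }

∷-cong : ∀ {a b p q} → a ≡ b → p ≈ q → a ∷ p ≈ b ∷ q
∷-cong a≡b p≈q = coeffwise λ { zero → a≡b ; (suc k) → coeff-≡ p≈q k }

+P-cong : ∀ {p p′ q q′} → p ≈ p′ → q ≈ q′ → p +P q ≈ p′ +P q′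
+P-cong {p} {p′} {q} {q′} p≈p′ q≈q′ = coeffwise λ k → begin
  coeff (p +P q) k            ≡⟨ coeff-+P p q k ⟩
  coeff p k ℤ.+ coeff q k     ≡⟨ cong₂ ℤ._+_ (coeff-≡ p≈p′ k) (coeff-≡ q≈q′ k) ⟩
  coeff p′ k ℤ.+ coeff q′ k   ≡⟨ coeff-+P p′ q′ k ⟨
  coeff (p′ +P q′) k          ∎
  where open ≡-Reasoning

+P-congˡ : ∀ p {q q′} → q ≈ q′ → p +P q ≈ p +P q′
+P-congˡ p = +P-cong (≈-refl {p})

+P-congʳ : ∀ r {p p′} → p ≈ p′ → p +P r ≈ p′ +P r
+P-congʳ r p≈p′ = +P-cong p≈p′ (≈-refl {r})

scaleP-cong : ∀ a {p q} → p ≈ q → scaleP a p ≈ scaleP a q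
scaleP-cong a {p} {q} p≈q = coeffwise λ k →
  trans (coeff-scaleP a p k) (trans (cong (a ℤ.*_) (coeff-≡ p≈q k)) (sym (coeff-scaleP a q k)))

-P-cong : ∀ {p q} → p ≈ q → -P p ≈ -P q
-P-cong = scaleP-cong -1ℤ

+P-assoc : ∀ p q r → (p +P q) +P r ≈ p +P (q +P r)
+P-assoc p q r = coeffwise λ k → begin
  coeff ((p +P q) +P r) k                     ≡⟨ coeff-+P (p +P q) r k ⟩
  coeff (p +P q) k ℤ.+ coeff r k              ≡⟨ cong (ℤ._+ coeff r k) (coeff-+P p q k) ⟩
  (coeff p k ℤ.+ coeff q k) ℤ.+ coeff r k     ≡⟨ ℤ.+-assoc (coeff p k) (coeff q k) (coeff r k) ⟩
  coeff p k ℤ.+ (coeff q k ℤ.+ coeff r k)     ≡⟨ cong₂ ℤ._+_ (refl {x = coeff p k}) (coeff-+P q r k) ⟨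
  coeff p k ℤ.+ coeff (q +P r) k              ≡⟨ coeff-+P p (q +P r) k ⟨
  coeff (p +P (q +P r)) k                     ∎
  where open ≡-Reasoning

+P-comm : ∀ p q → p +P q ≈ q +P p
+P-comm p q = coeffwise λ k →
  trans (coeff-+P p q k) (trans (ℤ.+-comm (coeff p k) (coeff q k)) (sym (coeff-+P q p k)))

+P-identityʳ : ∀ p → p +P 0P ≈ p
+P-identityʳ []      = ≈-refl
+P-identityʳ (a ∷ p) = ≈-refl

-P-inverseˡ : ∀ p → -P p +P p ≈ 0P
-P-inverseˡ p = coeffwise λ k → begin
  coeff (-P p +P p) k                  ≡⟨ coeff-+P (-P p) p k ⟩
  coeff (-P p) k ℤ.+ coeff p k         ≡⟨ cong (ℤ._+ coeff p k) (coeff-scaleP -1ℤ p k) ⟩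
  -1ℤ ℤ.* coeff p k ℤ.+ coeff p k      ≡⟨ cong (ℤ._+ coeff p k) (ℤ.-1*i≡-i (coeff p k)) ⟩
  - coeff p k ℤ.+ coeff p k            ≡⟨ ℤ.+-inverseˡ (coeff p k) ⟩
  0ℤ                                   ∎
  where open ≡-Reasoning

scaleP-distrib-+P : ∀ a p q → scaleP a (p +P q) ≈ scaleP a p +P scaleP a q
scaleP-distrib-+P a p q = coeffwise λ k → begin
  coeff (scaleP a (p +P q)) k                             ≡⟨ coeff-scaleP a (p +P q) k ⟩
  a ℤ.* coeff (p +P q) k                                  ≡⟨ cong (a ℤ.*_) (coeff-+P p q k) ⟩
  a ℤ.* (coeff p k ℤ.+ coeff q k)                         ≡⟨ ℤ.*-distribˡ-+ a (coeff p k) (coeff q k) ⟩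
  a ℤ.* coeff p k ℤ.+ a ℤ.* coeff q k                     ≡⟨ cong₂ ℤ._+_ (coeff-scaleP a p k) (coeff-scaleP a q k) ⟨
  coeff (scaleP a p) k ℤ.+ coeff (scaleP a q) k           ≡⟨ coeff-+P (scaleP a p) (scaleP a q) k ⟨
  coeff (scaleP a p +P scaleP a q) k                      ∎
  where open ≡-Reasoning

scaleP-zero : ∀ p → scaleP 0ℤ p ≈ 0P
scaleP-zero p = coeffwise λ k → coeff-scaleP 0ℤ p k

scaleP-assoc : ∀ a b p → scaleP (a ℤ.* b) p ≈ scaleP a (scaleP b p)
scaleP-assoc a b p = coeffwise λ k → begin
  coeff (scaleP (a ℤ.* b) p) k     ≡⟨ coeff-scaleP (a ℤ.* b) p k ⟩
  a ℤ.* b ℤ.* coeff p k            ≡⟨ ℤ.*-assoc a b (coeff p k) ⟩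
  a ℤ.* (b ℤ.* coeff p k)          ≡⟨ cong (a ℤ.*_) (coeff-scaleP b p k) ⟨
  a ℤ.* coeff (scaleP b p) k       ≡⟨ coeff-scaleP a (scaleP b p) k ⟨
  coeff (scaleP a (scaleP b p)) k  ∎
  where open ≡-Reasoning

scaleP-identity : ∀ p → scaleP 1ℤ p ≈ p
scaleP-identity p = coeffwise λ k → trans (coeff-scaleP 1ℤ p k) (ℤ.*-identityˡ (coeff p k))

+P-isAbelianGroup : IsAbelianGroup _≈_ _+P_ 0P -P_
+P-isAbelianGroup = record
  { isGroup = record
    { isMonoid = record
      { isSemigroup = record
        { isMagma = record
          { isEquivalence = record { refl = ≈-refl ; sym = ≈-sym ; trans = ≈-trans }
          ; ∙-cong        = +P-cong
          }
        ; assoc = +P-assoc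
        }
      ; identity = (λ _ → ≈-refl) , +P-identityʳ
      }
    ; inverse = -P-inverseˡ , λ p → ≈-trans (+P-comm p (-P p)) (-P-inverseˡ p)
    ; ⁻¹-cong = -P-cong
    }
  ; comm = +P-comm
  }

+P-abelianGroup : AbelianGroup _ _
+P-abelianGroup = record { isAbelianGroup = +P-isAbelianGroup }

+P-setoid : Setoid _ _
+P-setoid = AbelianGroup.setoid +P-abelianGroup

open import Relation.Binary.Reasoning.Setoid +P-setoid
open import Algebra.Properties.CommutativeSemigroup (AbelianGroup.commutativeSemigroup +P-abelianGroup)
  using (interchange; x∙yz≈y∙xz)

*P-zeroʳ : ∀ p → p *P 0P ≈ 0P
*P-zeroʳ []      = ≈-refl
*P-zeroʳ (a ∷ p) = coeffwise λ { zero → refl ; (suc k) → coeff-≡ (*P-zeroʳ p) k }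

*P-∷ʳ : ∀ p b q → p *P (b ∷ q) ≈ scaleP b p +P (0ℤ ∷ p *P q)
*P-∷ʳ []      b q = coeffwise λ { zero → refl ; (suc k) → refl }
*P-∷ʳ (a ∷ p) b q = ∷-cong (cong (ℤ._+ 0ℤ) (ℤ.*-comm a b)) (begin
  scaleP a q +P p *P (b ∷ q)                            ≈⟨ +P-congˡ (scaleP a q) (*P-∷ʳ p b q) ⟩
  scaleP a q +P (scaleP b p +P (0ℤ ∷ p *P q))           ≈⟨ x∙yz≈y∙xz (scaleP a q) (scaleP b p) _ ⟩
  scaleP b p +P (scaleP a q +P (0ℤ ∷ p *P q))           ∎)

*P-comm : ∀ p q → p *P q ≈ q *P p
*P-comm []      q = ≈-sym (*P-zeroʳ q)
*P-comm (a ∷ p) q = ≈-trans (+P-congˡ (scaleP a q) (∷-cong refl (*P-comm p q))) (≈-sym (*P-∷ʳ q a p))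

*P-congˡ : ∀ p {q q′} → q ≈ q′ → p *P q ≈ p *P q′
*P-congˡ []      q≈q′ = ≈-refl
*P-congˡ (a ∷ p) q≈q′ = +P-cong (scaleP-cong a q≈q′) (∷-cong refl (*P-congˡ p q≈q′))

*P-congʳ : ∀ r {p p′} → p ≈ p′ → p *P r ≈ p′ *P r
*P-congʳ r {p} {p′} p≈p′ = ≈-trans (*P-comm p r) (≈-trans (*P-congˡ r p≈p′) (*P-comm r p′))

*P-cong : ∀ {p p′ q q′} → p ≈ p′ → q ≈ q′ → p *P q ≈ p′ *P q′
*P-cong {p} {p′} {q} {q′} p≈p′ q≈q′ = ≈-trans (*P-congˡ p q≈q′) (*P-congʳ q′ p≈p′)

*P-distribˡ : ∀ p q r → p *P (q +P r) ≈ p *P q +P p *P r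
*P-distribˡ []      q r = ≈-refl
*P-distribˡ (a ∷ p) q r = begin
  scaleP a (q +P r) +P (0ℤ ∷ p *P (q +P r))
    ≈⟨ +P-cong (scaleP-distrib-+P a q r) (∷-cong refl (*P-distribˡ p q r)) ⟩
  (scaleP a q +P scaleP a r) +P ((0ℤ ∷ p *P q) +P (0ℤ ∷ p *P r))
    ≈⟨ interchange (scaleP a q) (scaleP a r) _ _ ⟩
  (scaleP a q +P (0ℤ ∷ p *P q)) +P (scaleP a r +P (0ℤ ∷ p *P r))
    ∎

*P-distribʳ : ∀ p q r → (q +P r) *P p ≈ q *P p +P r *P p
*P-distribʳ p q r = begin
  (q +P r) *P p      ≈⟨ *P-comm (q +P r) p ⟩
  p *P (q +P r)      ≈⟨ *P-distribˡ p q r ⟩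
  p *P q +P p *P r   ≈⟨ +P-cong (*P-comm p q) (*P-comm p r) ⟩
  q *P p +P r *P p   ∎

scaleP-*P : ∀ a p q → scaleP a p *P q ≈ scaleP a (p *P q)
scaleP-*P a []      q = ≈-refl
scaleP-*P a (b ∷ p) q = begin
  scaleP (a ℤ.* b) q +P (0ℤ ∷ scaleP a p *P q)
    ≈⟨ +P-cong (scaleP-assoc a b q) (∷-cong (sym (ℤ.*-zeroʳ a)) (scaleP-*P a p q)) ⟩
  scaleP a (scaleP b q) +P scaleP a (0ℤ ∷ p *P q)
    ≈⟨ scaleP-distrib-+P a (scaleP b q) (0ℤ ∷ p *P q) ⟨
  scaleP a (scaleP b q +P (0ℤ ∷ p *P q))
    ∎

shift-*P : ∀ p q → (0ℤ ∷ p) *P q ≈ 0ℤ ∷ p *P q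
shift-*P p q = +P-cong (scaleP-zero q) ≈-refl

*P-assoc : ∀ p q r → (p *P q) *P r ≈ p *P (q *P r)
*P-assoc []      q r = ≈-refl
*P-assoc (a ∷ p) q r = begin
  (scaleP a q +P (0ℤ ∷ p *P q)) *P r                ≈⟨ *P-distribʳ r (scaleP a q) (0ℤ ∷ p *P q) ⟩
  scaleP a q *P r +P (0ℤ ∷ p *P q) *P r             ≈⟨ +P-cong (scaleP-*P a q r) (shift-*P (p *P q) r) ⟩
  scaleP a (q *P r) +P (0ℤ ∷ (p *P q) *P r)         ≈⟨ +P-congˡ (scaleP a (q *P r)) (∷-cong refl (*P-assoc p q r)) ⟩
  scaleP a (q *P r) +P (0ℤ ∷ p *P (q *P r))         ∎

constP-*P : ∀ a p → constP a *P p ≈ scaleP a p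
constP-*P a p = ≈-trans (+P-congˡ (scaleP a p) (≈-sym []≈0∷[])) (+P-identityʳ (scaleP a p))

*P-identityˡ : ∀ p → 1P *P p ≈ p
*P-identityˡ p = ≈-trans (constP-*P 1ℤ p) (scaleP-identity p)

*P-identityʳ : ∀ p → p *P 1P ≈ p
*P-identityʳ p = ≈-trans (*P-comm p 1P) (*P-identityˡ p)

polyRing : CommutativeRing _ _
polyRing = record
  { isCommutativeRing = record
    { isRing = record
      { +-isAbelianGroup = +P-isAbelianGroup
      ; *-cong           = *P-cong
      ; *-assoc          = *P-assoc
      ; *-identity       = *P-identityˡ , *P-identityʳ
      ; distrib          = *P-distribˡ , *P-distribʳ
      }
    ; *-comm = *P-comm
    }
  }

∷-test : ∀ {a b p q} → Maybe (p ≈ q) → Maybe (a ∷ p ≈ b ∷ q)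
∷-test {a} {b} (just p≈q) with a ℤ.≟ b
... | yes a≡b = just (∷-cong a≡b p≈q)
... | no  _   = nothing
∷-test nothing = nothing

≈-test : ∀ p q → Maybe (p ≈ q)
≈-test []      []      = just ≈-refl
≈-test []      (b ∷ q) = Maybe.map (≈-trans []≈0∷[]) (∷-test (≈-test [] q))
≈-test (a ∷ p) []      = Maybe.map (λ e → ≈-trans e (≈-sym []≈0∷[])) (∷-test (≈-test p []))
≈-test (a ∷ p) (b ∷ q) = ∷-test (≈-test p q)

polyACR : AlmostCommutativeRing _ _
polyACR = fromCommutativeRing polyRing (≈-test [])

open import Tactic.RingSolver.NonReflective polyACR using (solve; _⊜_)
open import Algebra.Properties.Semiring.Exp (CommutativeRing.semiring polyRing) using (^-homo-*; ^-assocʳ)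
open import Algebra.Properties.Semiring.Mult (CommutativeRing.semiring polyRing) using (×-homo-+; ×-assocˡ; ×-congʳ)

-- Determinants

Mat : ℕ → Set
Mat n = Fin n → Fin n → Poly

sgn : ℕ → Poly
sgn k = constP (sign k)

minor : ∀ {n} → Fin (suc n) → Fin (suc n) → Mat (suc n) → Mat n
minor i j M r k = M (punchIn i r) (punchIn j k)

term : ∀ n → Mat (suc n) → Fin (suc n) → Poly
term n M j = sgn (toℕ j) *P M zero j *P det n (minor zero j M)

sumP-cong : ∀ n {f g : Fin n → Poly} → (∀ j → f j ≈ g j) → sumP n f ≈ sumP n g
sumP-cong zero    f≈g = ≈-refl
sumP-cong (suc n) f≈g = +P-cong (f≈g zero) (sumP-cong n (f≈g ∘ suc))

sumP-zero : ∀ n {f : Fin n → Poly} → (∀ j → f j ≈ 0P) → sumP n f ≈ 0P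
sumP-zero zero    f≈0 = ≈-refl
sumP-zero (suc n) f≈0 = +P-cong (f≈0 zero) (sumP-zero n (f≈0 ∘ suc))

sumP-+ : ∀ n (f g : Fin n → Poly) → sumP n (λ j → f j +P g j) ≈ sumP n f +P sumP n g
sumP-+ zero    f g = ≈-refl
sumP-+ (suc n) f g = ≈-trans (+P-congˡ (f zero +P g zero) (sumP-+ n (f ∘ suc) (g ∘ suc)))
                             (interchange (f zero) (g zero) _ _)

sumP-scale : ∀ n a (f : Fin n → Poly) → sumP n (λ j → a *P f j) ≈ a *P sumP n f
sumP-scale zero    a f = ≈-sym (*P-zeroʳ a)
sumP-scale (suc n) a f = ≈-trans (+P-congˡ (a *P f zero) (sumP-scale n a (f ∘ suc)))
                                 (≈-sym (*P-distribˡ a (f zero) _))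

sumP-linear : ∀ n a b (f g : Fin n → Poly) →
  sumP n (λ j → a *P f j +P b *P g j) ≈ a *P sumP n f +P b *P sumP n g
sumP-linear n a b f g =
  ≈-trans (sumP-+ n _ _) (+P-cong (sumP-scale n a f) (sumP-scale n b g))

sumP-punchIn : ∀ n (f : Fin (suc n) → Poly) p → sumP (suc n) f ≈ f p +P sumP n (f ∘ punchIn p)
sumP-punchIn n       f zero    = ≈-refl
sumP-punchIn (suc n) f (suc p) = ≈-trans (+P-congˡ (f zero) (sumP-punchIn n (f ∘ suc) p))
                                         (x∙yz≈y∙xz (f zero) (f (suc p)) _)

det-cong : ∀ n {M N : Mat n} → (∀ i j → M i j ≈ N i j) → det n M ≈ det n N
det-cong zero    M≈N = ≈-refl
det-cong (suc n) M≈N = sumP-cong (suc n) λ j →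
  *P-cong (*P-congˡ (sgn (toℕ j)) (M≈N zero j)) (det-cong n λ r k → M≈N (suc r) (punchIn j k))

-- The index of column c in a matrix from which column punchIn c j has been deleted.
survivor : ∀ {n} (c : Fin (suc (suc n))) (j : Fin (suc n)) → Fin (suc n)
survivor         zero    j       = zero
survivor         (suc c) zero    = c
survivor {suc n} (suc c) (suc j) = suc (survivor c j)

punchIn-survivor : ∀ {n} c j → punchIn (punchIn c j) (survivor {n} c j) ≡ c
punchIn-survivor         zero    j       = refl
punchIn-survivor         (suc c) zero    = refl
punchIn-survivor {suc n} (suc c) (suc j) = cong suc (punchIn-survivor c j)

punchIn-punchIn-survivor : ∀ {n} c j k →
  punchIn (punchIn c j) (punchIn (survivor {n} c j) k) ≡ punchIn c (punchIn j k)
punchIn-punchIn-survivor         zero    j       k       = refl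
punchIn-punchIn-survivor         (suc c) zero    k       = refl
punchIn-punchIn-survivor {suc n} (suc c) (suc j) zero    = refl
punchIn-punchIn-survivor {suc n} (suc c) (suc j) (suc k) = cong suc (punchIn-punchIn-survivor c j k)

record ColumnSplit {n} (c : Fin (suc n)) (a b : Poly) (M N P : Mat (suc n)) : Set where
  field
    at-c  : ∀ i → M i c ≈ a *P N i c +P b *P P i c
    awayˡ : ∀ i k → M i (punchIn c k) ≈ N i (punchIn c k)
    awayʳ : ∀ i k → M i (punchIn c k) ≈ P i (punchIn c k)

minor-split : ∀ {n c a b M N P} → ColumnSplit {suc n} c a b M N P → ∀ k →
  ColumnSplit (survivor c k) a b
    (minor zero (punchIn c k) M) (minor zero (punchIn c k) N) (minor zero (punchIn c k) P)
minor-split {c = c} {a} {b} {M} {N} {P} split k = record { at-c = at ; awayˡ = awayˡ′ ; awayʳ = awayʳ′ }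
  where
  open ColumnSplit split
  c′ = survivor c k
  j  = punchIn c k
  at : ∀ i → M (suc i) (punchIn j c′) ≈ a *P N (suc i) (punchIn j c′) +P b *P P (suc i) (punchIn j c′)
  at i rewrite punchIn-survivor c k = at-c (suc i)
  awayˡ′ : ∀ i l → M (suc i) (punchIn j (punchIn c′ l)) ≈ N (suc i) (punchIn j (punchIn c′ l))
  awayˡ′ i l rewrite punchIn-punchIn-survivor c k l = awayˡ (suc i) (punchIn k l)
  awayʳ′ : ∀ i l → M (suc i) (punchIn j (punchIn c′ l)) ≈ P (suc i) (punchIn j (punchIn c′ l))
  awayʳ′ i l rewrite punchIn-punchIn-survivor c k l = awayʳ (suc i) (punchIn k l)

mutual
  det-linear : ∀ n {c a b M N P} → ColumnSplit c a b M N P →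
    det (suc n) M ≈ a *P det (suc n) N +P b *P det (suc n) P
  det-linear n {c} {a} {b} {M} {N} {P} split = begin
    det (suc n) M
      ≈⟨ sumP-punchIn n (term n M) c ⟩
    term n M c +P sumP n (term n M ∘ punchIn c)
      ≈⟨ +P-cong (term-at-c n split) (≈-trans (sumP-cong n (term-away n split))
                                              (sumP-linear n a b (term n N ∘ punchIn c) (term n P ∘ punchIn c))) ⟩
    (a *P term n N c +P b *P term n P c) +P
      (a *P sumP n (term n N ∘ punchIn c) +P b *P sumP n (term n P ∘ punchIn c))
      ≈⟨ regroup a b (term n N c) (term n P c) _ _ ⟩
    a *P (term n N c +P sumP n (term n N ∘ punchIn c)) +P b *P (term n P c +P sumP n (term n P ∘ punchIn c))
      ≈⟨ +P-cong (*P-congˡ a (sumP-punchIn n (term n N) c)) (*P-congˡ b (sumP-punchIn n (term n P) c)) ⟨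
    a *P det (suc n) N +P b *P det (suc n) P
      ∎
    where
    regroup : ∀ a b x y u v → (a *P x +P b *P y) +P (a *P u +P b *P v) ≈ a *P (x +P u) +P b *P (y +P v)
    regroup = solve-∀ polyACR

  term-at-c : ∀ n {c a b M N P} → ColumnSplit c a b M N P →
    term n M c ≈ a *P term n N c +P b *P term n P c
  term-at-c n {c} {a} {b} {M} {N} {P} split = begin
    s *P M zero c *P det n (minor zero c M)
      ≈⟨ *P-cong (*P-congˡ s (at-c zero)) (det-cong n λ i k → awayˡ (suc i) k) ⟩
    s *P (a *P N zero c +P b *P P zero c) *P det n (minor zero c N)
      ≈⟨ distribute s (N zero c) (P zero c) (det n (minor zero c N)) a b ⟩
    a *P (s *P N zero c *P det n (minor zero c N)) +P b *P (s *P P zero c *P det n (minor zero c N))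
      ≈⟨ +P-congˡ (a *P term n N c) (*P-congˡ b (*P-congˡ (s *P P zero c) minorN≈minorP)) ⟩
    a *P term n N c +P b *P term n P c
      ∎
    where
    open ColumnSplit split
    s = sgn (toℕ c)
    minorN≈minorP : det n (minor zero c N) ≈ det n (minor zero c P)
    minorN≈minorP = det-cong n λ i k → ≈-trans (≈-sym (awayˡ (suc i) k)) (awayʳ (suc i) k)
    distribute : ∀ s x y d a b → s *P (a *P x +P b *P y) *P d ≈ a *P (s *P x *P d) +P b *P (s *P y *P d)
    distribute = solve-∀ polyACR

  term-away : ∀ n {c a b M N P} → ColumnSplit c a b M N P → ∀ k →
    let j = punchIn c k in term n M j ≈ a *P term n N j +P b *P term n P j
  term-away (suc n) {c} {a} {b} {M} {N} {P} split k = begin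
    s *P M zero j *P det (suc n) (minor zero j M)
      ≈⟨ *P-congˡ (s *P M zero j) (det-linear n (minor-split split k)) ⟩
    s *P M zero j *P (a *P det (suc n) (minor zero j N) +P b *P det (suc n) (minor zero j P))
      ≈⟨ distribute s (M zero j) _ _ a b ⟩
    a *P (s *P M zero j *P det (suc n) (minor zero j N)) +P b *P (s *P M zero j *P det (suc n) (minor zero j P))
      ≈⟨ +P-cong (*P-congˡ a (*P-congʳ _ (*P-congˡ s (awayˡ zero k))))
                 (*P-congˡ b (*P-congʳ _ (*P-congˡ s (awayʳ zero k)))) ⟩
    a *P term (suc n) N j +P b *P term (suc n) P j
      ∎
    where
    open ColumnSplit split
    j = punchIn c k
    s = sgn (toℕ j)
    distribute : ∀ s x dN dP a b → s *P x *P (a *P dN +P b *P dP) ≈ a *P (s *P x *P dN) +P b *P (s *P x *P dP)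
    distribute = solve-∀ polyACR

det-zero-column : ∀ n (c : Fin (suc n)) (M : Mat (suc n)) → (∀ i → M i c ≈ 0P) → det (suc n) M ≈ 0P
det-zero-column n c M col≈0 = det-linear n {c} {0P} {0P} {M} {M} {M}
  record { at-c = col≈0 ; awayˡ = λ _ _ → ≈-refl ; awayʳ = λ _ _ → ≈-refl }

sgn-suc : ∀ k → sgn (suc k) ≈ -P sgn k
sgn-suc zero          = ≈-refl
sgn-suc (suc zero)    = ≈-refl
sgn-suc (suc (suc k)) = sgn-suc k

sgn-+ : ∀ a b → sgn (a + b) ≈ sgn a *P sgn b
sgn-+ zero          b = ≈-sym (*P-identityˡ (sgn b))
sgn-+ (suc zero)    b = ≈-trans (sgn-suc b) (≈-sym (constP-*P -1ℤ (sgn b)))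
sgn-+ (suc (suc a)) b = sgn-+ a b

sgn-double : ∀ a → sgn (a + a) ≈ 1P
sgn-double zero    = ≈-refl
sgn-double (suc a) rewrite ℕ.+-suc a a = sgn-double a

sgn-survivor : ∀ {n} c k → sgn (toℕ (punchIn c k) + toℕ (survivor {n} c k)) ≈ sgn (suc (toℕ c + toℕ k))
sgn-survivor zero    k    = ≈-reflexive (cong sgn (ℕ.+-identityʳ (suc (toℕ k))))
sgn-survivor (suc c) zero = ≈-reflexive (cong sgn (sym (ℕ.+-identityʳ (toℕ c))))
sgn-survivor {suc n} (suc c) (suc k)
  rewrite ℕ.+-suc (toℕ (punchIn c k)) (toℕ (survivor c k)) | ℕ.+-suc (toℕ c) (toℕ k) = sgn-survivor c k

punchIn-inject₁-self : ∀ {m} (p : Fin (suc m)) → punchIn (inject₁ p) p ≡ suc p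
punchIn-inject₁-self         zero    = refl
punchIn-inject₁-self {suc m} (suc p) = cong suc (punchIn-inject₁-self p)

punchIn-suc-self : ∀ {m} (p : Fin (suc m)) → punchIn (suc p) p ≡ inject₁ p
punchIn-suc-self         zero    = refl
punchIn-suc-self {suc m} (suc p) = cong suc (punchIn-suc-self p)

punchIn-inject₁-suc : ∀ {m} (p k : Fin (suc m)) →
  punchIn (inject₁ p) k ≡ punchIn (suc p) k ⊎ (punchIn (inject₁ p) k ≡ suc p × punchIn (suc p) k ≡ inject₁ p)
punchIn-inject₁-suc         zero    zero    = inj₂ (refl , refl)
punchIn-inject₁-suc         zero    (suc k) = inj₁ refl
punchIn-inject₁-suc {suc m} (suc p) zero    = inj₁ refl
punchIn-inject₁-suc {suc m} (suc p) (suc k) with punchIn-inject₁-suc p k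
... | inj₁ e          = inj₁ (cong suc e)
... | inj₂ (e₁ , e₂)  = inj₂ (cong suc e₁ , cong suc e₂)

-- The columns other than inject₁ p and suc p, and the position q of that pair
-- (as inject₁ q, suc q) once one of them has been deleted.
outside : ∀ {m} (p : Fin (suc m)) (k : Fin m) → Fin (suc (suc m))
outside p k = punchIn (inject₁ p) (punchIn p k)

pairPosition : ∀ {m} (p : Fin (suc m)) (k : Fin m) → Fin m
pairPosition {suc m} zero    k       = zero
pairPosition         (suc p) zero    = p
pairPosition         (suc p) (suc k) = suc (pairPosition p k)

punchIn-outside-inject₁ : ∀ {m} p k → punchIn (outside {m} p k) (inject₁ (pairPosition p k)) ≡ inject₁ p
punchIn-outside-inject₁ {suc m} zero    k       = refl
punchIn-outside-inject₁         (suc p) zero    = refl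
punchIn-outside-inject₁         (suc p) (suc k) = cong suc (punchIn-outside-inject₁ p k)

punchIn-outside-suc : ∀ {m} p k → punchIn (outside {m} p k) (suc (pairPosition p k)) ≡ suc p
punchIn-outside-suc {suc m} zero    k       = refl
punchIn-outside-suc         (suc p) zero    = refl
punchIn-outside-suc         (suc p) (suc k) = cong suc (punchIn-outside-suc p k)

-- The terms of the two equal columns cancel, and every other minor again has
-- two equal adjacent columns.
det-adjacent-equal : ∀ m (M : Mat (suc (suc m))) (p : Fin (suc m)) →
  (∀ i → M i (inject₁ p) ≈ M i (suc p)) → det (suc (suc m)) M ≈ 0P
det-adjacent-equal m M p cols≈ = begin
  det (suc (suc m)) M
    ≈⟨ sumP-punchIn (suc m) (T M) a ⟩
  T M a +P sumP (suc m) (T M ∘ punchIn a)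
    ≈⟨ +P-congˡ (T M a) (sumP-punchIn m (T M ∘ punchIn a) p) ⟩
  T M a +P (T M (punchIn a p) +P sumP m (T M ∘ outside p))
    ≈⟨ +P-congˡ (T M a) (+P-cong (≈-reflexive (cong (T M) (punchIn-inject₁-self p)))
                                 (sumP-zero m (outside-vanishes m M p cols≈))) ⟩
  T M a +P (T M b +P 0P)
    ≈⟨ +P-cong (*P-cong (*P-cong (≈-reflexive (cong sgn (toℕ-inject₁ p))) (cols≈ zero)) (det-cong (suc m) minors≈))
               (+P-identityʳ (T M b)) ⟩
  s *P M zero b *P d +P sgn (suc (toℕ p)) *P M zero b *P d
    ≈⟨ +P-congˡ (s *P M zero b *P d) (*P-congʳ d (*P-congʳ (M zero b) (sgn-suc (toℕ p)))) ⟩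
  s *P M zero b *P d +P -P s *P M zero b *P d
    ≈⟨ cancel s (M zero b) d ⟩
  0P
    ∎
  where
  a = inject₁ p
  b = suc p
  T = term (suc m)
  s = sgn (toℕ p)
  d = det (suc m) (minor zero b M)
  minors≈ : ∀ i k → minor zero a M i k ≈ minor zero b M i k
  minors≈ i k with punchIn-inject₁-suc p k
  ... | inj₁ e         = ≈-reflexive (cong (M (suc i)) e)
  ... | inj₂ (e₁ , e₂) rewrite e₁ | e₂ = ≈-sym (cols≈ (suc i))
  cancel : ∀ s x d → s *P x *P d +P -P s *P x *P d ≈ 0P
  cancel = solve-∀ polyACR
  outside-vanishes : ∀ m (M : Mat (suc (suc m))) p → (∀ i → M i (inject₁ p) ≈ M i (suc p)) →
    ∀ k → term (suc m) M (outside p k) ≈ 0P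
  outside-vanishes (suc m) M p cols≈ k =
    ≈-trans (*P-congˡ (sgn (toℕ j) *P M zero j) (det-adjacent-equal m (minor zero j M) (pairPosition p k) cols≈′))
            (*P-zeroʳ (sgn (toℕ j) *P M zero j))
    where
    j = outside p k
    cols≈′ : ∀ i → M (suc i) (punchIn j (inject₁ (pairPosition p k))) ≈ M (suc i) (punchIn j (suc (pairPosition p k)))
    cols≈′ i rewrite punchIn-outside-inject₁ p k | punchIn-outside-suc p k = cols≈ (suc i)

term-zero-column : ∀ n (M : Mat (suc n)) c → (∀ r → M (suc r) c ≈ 0P) → ∀ k → term n M (punchIn c k) ≈ 0P
term-zero-column (suc n) M c rest≈0 k =
  ≈-trans (*P-congˡ (sgn (toℕ j) *P M zero j) (det-zero-column n (survivor c k) (minor zero j M) rest≈0′))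
          (*P-zeroʳ (sgn (toℕ j) *P M zero j))
  where
  j = punchIn c k
  rest≈0′ : ∀ r → M (suc r) (punchIn j (survivor c k)) ≈ 0P
  rest≈0′ r rewrite punchIn-survivor c k = rest≈0 r

det-unit-column : ∀ n (M : Mat (suc n)) (i c : Fin (suc n)) →
  M i c ≈ 1P → (∀ r → M (punchIn i r) c ≈ 0P) → det (suc n) M ≈ sgn (toℕ i + toℕ c) *P det n (minor i c M)
det-unit-column n M zero c pivot rest≈0 = begin
  det (suc n) M                                     ≈⟨ sumP-punchIn n (term n M) c ⟩
  term n M c +P sumP n (term n M ∘ punchIn c)       ≈⟨ +P-cong term-c (sumP-zero n (term-zero-column n M c rest≈0)) ⟩
  sgn (toℕ c) *P det n (minor zero c M) +P 0P       ≈⟨ +P-identityʳ _ ⟩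
  sgn (toℕ c) *P det n (minor zero c M)             ∎
  where
  term-c : term n M c ≈ sgn (toℕ c) *P det n (minor zero c M)
  term-c = *P-congʳ (det n (minor zero c M))
             (≈-trans (*P-congˡ (sgn (toℕ c)) pivot) (*P-identityʳ (sgn (toℕ c))))
det-unit-column (suc n) M (suc i) c pivot rest≈0 = begin
  det (suc (suc n)) M
    ≈⟨ sumP-punchIn (suc n) (term (suc n) M) c ⟩
  term (suc n) M c +P sumP (suc n) (term (suc n) M ∘ punchIn c)
    ≈⟨ +P-cong term-c (sumP-cong (suc n) term-k) ⟩
  0P +P sumP (suc n) (λ k → σ *P term n (minor (suc i) c M) k)
    ≈⟨ sumP-scale (suc n) σ (term n (minor (suc i) c M)) ⟩
  σ *P det (suc n) (minor (suc i) c M)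
    ∎
  where
  σ = sgn (suc (toℕ i) + toℕ c)
  term-c : term (suc n) M c ≈ 0P
  term-c = *P-congʳ (det (suc n) (minor zero c M))
             (≈-trans (*P-congˡ (sgn (toℕ c)) (rest≈0 zero)) (*P-zeroʳ (sgn (toℕ c))))
  signs : ∀ k → sgn (toℕ (punchIn c k)) *P sgn (toℕ i + toℕ (survivor c k)) ≈ σ *P sgn (toℕ k)
  signs k = begin
    sgn j *P sgn (toℕ i + c′)                   ≈⟨ sgn-+ j (toℕ i + c′) ⟨
    sgn (j + (toℕ i + c′))                      ≡⟨ cong sgn (swap j (toℕ i) c′) ⟩
    sgn (toℕ i + (j + c′))                      ≈⟨ sgn-+ (toℕ i) (j + c′) ⟩
    sgn (toℕ i) *P sgn (j + c′)                 ≈⟨ *P-congˡ (sgn (toℕ i)) (sgn-survivor c k) ⟩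
    sgn (toℕ i) *P sgn (suc (toℕ c + toℕ k))    ≈⟨ sgn-+ (toℕ i) (suc (toℕ c + toℕ k)) ⟨
    sgn (toℕ i + suc (toℕ c + toℕ k))           ≡⟨ cong sgn (reassoc (toℕ i) (toℕ c) (toℕ k)) ⟩
    sgn (suc (toℕ i) + toℕ c + toℕ k)           ≈⟨ sgn-+ (suc (toℕ i) + toℕ c) (toℕ k) ⟩
    σ *P sgn (toℕ k)                            ∎
    where
    j  = toℕ (punchIn c k)
    c′ = toℕ (survivor c k)
    swap : ∀ j i c → j + (i + c) ≡ i + (j + c)
    swap = NatSolver.solve-∀
    reassoc : ∀ i c k → i + suc (c + k) ≡ suc i + c + k
    reassoc = NatSolver.solve-∀
  term-k : ∀ k → term (suc n) M (punchIn c k) ≈ σ *P term n (minor (suc i) c M) k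
  term-k k = begin
    s *P M zero j *P det (suc n) (minor zero j M)
      ≈⟨ *P-congˡ (s *P M zero j) (det-unit-column n (minor zero j M) i c′ pivot′ rest≈0′) ⟩
    s *P M zero j *P (sgn (toℕ i + toℕ c′) *P det n (minor i c′ (minor zero j M)))
      ≈⟨ *P-congˡ (s *P M zero j) (*P-congˡ (sgn (toℕ i + toℕ c′)) (det-cong n minors≡)) ⟩
    s *P M zero j *P (sgn (toℕ i + toℕ c′) *P d)
      ≈⟨ reorder s (M zero j) (sgn (toℕ i + toℕ c′)) d ⟩
    (s *P sgn (toℕ i + toℕ c′)) *P M zero j *P d
      ≈⟨ *P-congʳ d (*P-congʳ (M zero j) (signs k)) ⟩
    (σ *P sgn (toℕ k)) *P M zero j *P d
      ≈⟨ reassociate σ (sgn (toℕ k)) (M zero j) d ⟩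
    σ *P term n (minor (suc i) c M) k
      ∎
    where
    j  = punchIn c k
    s  = sgn (toℕ j)
    c′ = survivor c k
    d  = det n (minor zero k (minor (suc i) c M))
    pivot′ : M (suc i) (punchIn j c′) ≈ 1P
    pivot′ rewrite punchIn-survivor c k = pivot
    rest≈0′ : ∀ r → M (suc (punchIn i r)) (punchIn j c′) ≈ 0P
    rest≈0′ r rewrite punchIn-survivor c k = rest≈0 (suc r)
    minors≡ : ∀ r l → minor i c′ (minor zero j M) r l ≈ minor zero k (minor (suc i) c M) r l
    minors≡ r l = ≈-reflexive (cong (M (suc (punchIn i r))) (punchIn-punchIn-survivor c k l))
    reorder : ∀ s x t d → s *P x *P (t *P d) ≈ (s *P t) *P x *P d
    reorder = solve-∀ polyACR
    reassociate : ∀ σ t x d → (σ *P t) *P x *P d ≈ σ *P (t *P x *P d)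
    reassociate = solve-∀ polyACR

replaceColumn : ∀ {n} → Fin n → (Fin n → Poly) → Mat n → Mat n
replaceColumn c v M r k with k ≟ c
... | yes _ = v r
... | no  _ = M r k

replaceColumn-≡ : ∀ {n} (c : Fin n) v M r → replaceColumn c v M r c ≡ v r
replaceColumn-≡ c v M r with c ≟ c
... | yes _  = refl
... | no c≢c = ⊥-elim (c≢c refl)

replaceColumn-≢ : ∀ {n} (c : Fin n) v M r {k} → k ≢ c → replaceColumn c v M r k ≡ M r k
replaceColumn-≢ c v M r {k} k≢c with k ≟ c
... | yes k≡c = ⊥-elim (k≢c k≡c)
... | no  _   = refl

replaceColumn-punchIn : ∀ {n} (c : Fin (suc n)) v M r k → replaceColumn c v M r (punchIn c k) ≡ M r (punchIn c k)
replaceColumn-punchIn c v M r k = replaceColumn-≢ c v M r (punchInᵢ≢i c k)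

unitVector : ∀ {n} → Fin n → Fin n → Poly
unitVector c r with r ≟ c
... | yes _ = 1P
... | no  _ = 0P

unitVector-≡ : ∀ {n} (c : Fin n) → unitVector c c ≡ 1P
unitVector-≡ c with c ≟ c
... | yes _  = refl
... | no c≢c = ⊥-elim (c≢c refl)

unitVector-≢ : ∀ {n} (c : Fin n) {r} → r ≢ c → unitVector c r ≡ 0P
unitVector-≢ c {r} r≢c with r ≟ c
... | yes r≡c = ⊥-elim (r≢c r≡c)
... | no  _   = refl

det-replaceColumn-unitVector : ∀ n (M : Mat (suc n)) i c →
  det (suc n) (replaceColumn c (unitVector i) M) ≈ sgn (toℕ i + toℕ c) *P det n (minor i c M)
det-replaceColumn-unitVector n M i c =
  ≈-trans (det-unit-column n (replaceColumn c (unitVector i) M) i c pivot rest≈0)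
          (*P-congˡ (sgn (toℕ i + toℕ c)) (det-cong n λ r k →
            ≈-reflexive (replaceColumn-punchIn c (unitVector i) M (punchIn i r) k)))
  where
  pivot : replaceColumn c (unitVector i) M i c ≈ 1P
  pivot rewrite replaceColumn-≡ c (unitVector i) M i | unitVector-≡ i = ≈-refl
  rest≈0 : ∀ r → replaceColumn c (unitVector i) M (punchIn i r) c ≈ 0P
  rest≈0 r rewrite replaceColumn-≡ c (unitVector i) M (punchIn i r) | unitVector-≢ i (punchInᵢ≢i i r) = ≈-refl

det-replaceColumn-unitVector-diag : ∀ n (M : Mat (suc n)) c →
  det (suc n) (replaceColumn c (unitVector c) M) ≈ det n (minor c c M)
det-replaceColumn-unitVector-diag n M c =
  ≈-trans (det-replaceColumn-unitVector n M c c)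
          (≈-trans (*P-congʳ (det n (minor c c M)) (sgn-double (toℕ c))) (*P-identityˡ (det n (minor c c M))))

suc≢inject₁ : ∀ {m} (p : Fin (suc m)) → suc p ≢ inject₁ p
suc≢inject₁ p e = punchInᵢ≢i (inject₁ p) p (trans (punchIn-inject₁-self p) e)

det-subtract-adjacent : ∀ m (M : Mat (suc (suc m))) p →
  det (suc (suc m)) (replaceColumn (inject₁ p) (λ r → M r (inject₁ p) +P -P M r (suc p)) M) ≈ det (suc (suc m)) M
det-subtract-adjacent m M p = begin
  det (suc (suc m)) M′
    ≈⟨ det-linear (suc m) split ⟩
  1P *P det (suc (suc m)) M +P -P 1P *P det (suc (suc m)) Mᵇ
    ≈⟨ +P-congˡ (1P *P det (suc (suc m)) M) (*P-congˡ (-P 1P) (det-adjacent-equal m Mᵇ p equal)) ⟩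
  1P *P det (suc (suc m)) M +P -P 1P *P 0P
    ≈⟨ simplify (det (suc (suc m)) M) ⟩
  det (suc (suc m)) M
    ∎
  where
  a = inject₁ p
  M′ = replaceColumn a (λ r → M r a +P -P M r (suc p)) M
  Mᵇ = replaceColumn a (λ r → M r (suc p)) M
  split : ColumnSplit a 1P (-P 1P) M′ M Mᵇ
  split = record
    { at-c  = λ r → ≈-trans (≈-reflexive (replaceColumn-≡ a _ M r))
                            (≈-trans (as-combination (M r a) (M r (suc p)))
                                     (+P-congˡ (1P *P M r a) (*P-congˡ (-P 1P) (≈-reflexive (sym (replaceColumn-≡ a _ M r))))))
    ; awayˡ = λ r k → ≈-reflexive (replaceColumn-punchIn a _ M r k)
    ; awayʳ = λ r k → ≈-reflexive (trans (replaceColumn-punchIn a _ M r k) (sym (replaceColumn-punchIn a _ M r k)))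
    }
    where
    as-combination : ∀ x z → x +P -P z ≈ 1P *P x +P -P 1P *P z
    as-combination = solve-∀ polyACR
  equal : ∀ r → Mᵇ r a ≈ Mᵇ r (suc p)
  equal r = ≈-reflexive (trans (replaceColumn-≡ a _ M r) (sym (replaceColumn-≢ a _ M r (suc≢inject₁ p))))
  simplify : ∀ d → 1P *P d +P -P 1P *P 0P ≈ d
  simplify = solve-∀ polyACR

record Twins {m} (y : Poly) (p : Fin (suc m)) (M : Mat (suc (suc m))) : Set where
  field
    columns : ∀ r → r ≢ inject₁ p → r ≢ suc p → M r (inject₁ p) ≈ M r (suc p)
    diagˡ   : M (inject₁ p) (inject₁ p) ≈ y +P M (inject₁ p) (suc p)
    diagʳ   : M (suc p) (suc p) ≈ y +P M (suc p) (inject₁ p)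

module _ {m y p M} (twins : Twins {m} y p M) where
  open Twins twins
  private
    a = inject₁ p
    b = suc p

  twin-difference : ∀ r → M r a +P -P M r b ≈ y *P unitVector a r +P -P y *P unitVector b r
  twin-difference r = by-cases r (r ≟ a) (r ≟ b)
    where
    on-a : ∀ y z → (y +P z) +P -P z ≈ y *P 1P +P -P y *P 0P
    on-a = solve-∀ polyACR
    on-b : ∀ y z → z +P -P (y +P z) ≈ y *P 0P +P -P y *P 1P
    on-b = solve-∀ polyACR
    elsewhere : ∀ y z → z +P -P z ≈ y *P 0P +P -P y *P 0P
    elsewhere = solve-∀ polyACR
    by-cases : ∀ r → Dec (r ≡ a) → Dec (r ≡ b) → M r a +P -P M r b ≈ y *P unitVector a r +P -P y *P unitVector b r
    by-cases r (yes refl) _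
      rewrite unitVector-≡ a | unitVector-≢ b (≢-sym (suc≢inject₁ p)) =
      ≈-trans (+P-congʳ (-P M a b) diagˡ) (on-a y (M a b))
    by-cases r (no r≢a) (yes refl)
      rewrite unitVector-≢ a (suc≢inject₁ p) | unitVector-≡ b =
      ≈-trans (+P-congˡ (M b a) (-P-cong diagʳ)) (on-b y (M b a))
    by-cases r (no r≢a) (no r≢b)
      rewrite unitVector-≢ a r≢a | unitVector-≢ b r≢b =
      ≈-trans (+P-congˡ (M r a) (-P-cong (≈-sym (columns r r≢a r≢b)))) (elsewhere y (M r a))

  det-twin-minor : det (suc m) (minor b a M) ≈ det (suc m) (minor b b M) +P -P (y *P det m (minor p p (minor b b M)))
  det-twin-minor = begin
    det (suc m) (minor b a M)
      ≈⟨ det-linear m split ⟩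
    1P *P det (suc m) N +P -P y *P det (suc m) (replaceColumn p (unitVector p) N)
      ≈⟨ +P-congˡ (1P *P det (suc m) N) (*P-congˡ (-P y) (det-replaceColumn-unitVector-diag m N p)) ⟩
    1P *P det (suc m) N +P -P y *P det m (minor p p N)
      ≈⟨ simplify y (det (suc m) N) (det m (minor p p N)) ⟩
    det (suc m) N +P -P (y *P det m (minor p p N))
      ∎
    where
    N = minor b b M
    simplify : ∀ y d e → 1P *P d +P -P y *P e ≈ d +P -P (y *P e)
    simplify = solve-∀ polyACR
    same-columns : ∀ k → punchIn a (punchIn p k) ≡ punchIn b (punchIn p k)
    same-columns k with punchIn-inject₁-suc p (punchIn p k)
    ... | inj₁ e         = e
    ... | inj₂ (e₁ , _)  = ⊥-elim (punchInᵢ≢i p k (punchIn-injective a (punchIn p k) p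
                                     (trans e₁ (sym (punchIn-inject₁-self p)))))
    away : ∀ r k → minor b a M r (punchIn p k) ≈ N r (punchIn p k)
    away r k = ≈-reflexive (cong (M (punchIn b r)) (same-columns k))
    from-diag : ∀ y z → z ≈ 1P *P (y +P z) +P -P y *P 1P
    from-diag = solve-∀ polyACR
    as-combination : ∀ y z → z ≈ 1P *P z +P -P y *P 0P
    as-combination = solve-∀ polyACR
    at-p : ∀ r → Dec (r ≡ p) → minor b a M r p ≈ 1P *P N r p +P -P y *P unitVector p r
    at-p r (yes refl) rewrite punchIn-inject₁-self p | punchIn-suc-self p | unitVector-≡ p =
      ≈-trans (from-diag y (M a b)) (+P-congʳ (-P y *P 1P) (*P-congˡ 1P (≈-sym diagˡ)))
    at-p r (no r≢p) rewrite punchIn-inject₁-self p | punchIn-suc-self p | unitVector-≢ p r≢p =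
      ≈-trans (≈-sym (columns (punchIn b r) row≢a (punchInᵢ≢i b r))) (as-combination y (M (punchIn b r) a))
      where
      row≢a : punchIn b r ≢ a
      row≢a e = r≢p (punchIn-injective b r p (trans e (sym (punchIn-suc-self p))))
    split : ColumnSplit p 1P (-P y) (minor b a M) N (replaceColumn p (unitVector p) N)
    split = record
      { at-c  = λ r → ≈-trans (at-p r (r ≟ p)) (+P-congˡ (1P *P N r p)
                          (*P-congˡ (-P y) (≈-reflexive (sym (replaceColumn-≡ p (unitVector p) N r)))))
      ; awayˡ = away
      ; awayʳ = λ r k → ≈-trans (away r k) (≈-reflexive (sym (replaceColumn-punchIn p (unitVector p) N r k)))
      }

  det-twins : det (suc (suc m)) M ≈
    y *P det (suc m) (minor a a M) +P y *P (det (suc m) (minor b b M) +P -P (y *P det m (minor p p (minor b b M))))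
  det-twins = begin
    det (suc (suc m)) M
      ≈⟨ det-subtract-adjacent m M p ⟨
    det (suc (suc m)) (replaceColumn a (λ r → M r a +P -P M r b) M)
      ≈⟨ det-linear (suc m) split ⟩
    y *P det (suc (suc m)) (replaceColumn a (unitVector a) M) +P -P y *P det (suc (suc m)) (replaceColumn a (unitVector b) M)
      ≈⟨ +P-cong (*P-congˡ y (det-replaceColumn-unitVector-diag (suc m) M a))
                 (*P-congˡ (-P y) (det-replaceColumn-unitVector (suc m) M b a)) ⟩
    y *P det (suc m) (minor a a M) +P -P y *P (sgn (toℕ b + toℕ a) *P det (suc m) (minor b a M))
      ≈⟨ +P-congˡ (y *P det (suc m) (minor a a M)) (*P-congˡ (-P y) (*P-cong sgn-ba det-twin-minor)) ⟩
    y *P dA +P -P y *P (-P 1P *P (dB +P -P (y *P dAB)))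
      ≈⟨ simplify y dA dB dAB ⟩
    y *P dA +P y *P (dB +P -P (y *P dAB))
      ∎
    where
    dA  = det (suc m) (minor a a M)
    dB  = det (suc m) (minor b b M)
    dAB = det m (minor p p (minor b b M))
    sgn-ba : sgn (toℕ b + toℕ a) ≈ -P 1P
    sgn-ba rewrite toℕ-inject₁ p = ≈-trans (sgn-suc (toℕ p + toℕ p)) (-P-cong (sgn-double (toℕ p)))
    simplify : ∀ y d e f → y *P d +P -P y *P (-P 1P *P (e +P -P (y *P f))) ≈ y *P d +P y *P (e +P -P (y *P f))
    simplify = solve-∀ polyACR
    split : ColumnSplit a y (-P y) (replaceColumn a (λ r → M r a +P -P M r b) M)
                                   (replaceColumn a (unitVector a) M) (replaceColumn a (unitVector b) M)
    split = record
      { at-c  = λ r → ≈-trans (≈-reflexive (replaceColumn-≡ a _ M r))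
                        (≈-trans (twin-difference r)
                          (≈-sym (+P-cong (*P-congˡ y (≈-reflexive (replaceColumn-≡ a _ M r)))
                                          (*P-congˡ (-P y) (≈-reflexive (replaceColumn-≡ a _ M r))))))
      ; awayˡ = λ r k → ≈-reflexive (trans (replaceColumn-punchIn a _ M r k) (sym (replaceColumn-punchIn a _ M r k)))
      ; awayʳ = λ r k → ≈-reflexive (trans (replaceColumn-punchIn a _ M r k) (sym (replaceColumn-punchIn a _ M r k)))
      }

-- Ring expressions

-- Stated over an arbitrary raw ring so that they can be instantiated both to
-- polynomials and to the expressions handed to the ring solver.
module Forms {c ℓ} (R : RawRing c ℓ) where
  open RawRing R using (Carrier; 1#; rawSemiring) renaming (_+_ to _⊕_; _*_ to _⊗_; -_ to ⊝_)
  open import Algebra.Definitions.RawSemiring rawSemiring public using (_^_) renaming (_×_ to _·_)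

  step : Carrier → Carrier → Carrier → Carrier
  step y p q = y ⊗ p ⊕ y ⊗ (p ⊕ ⊝ (y ⊗ q))

  -- Multi-affine in the pairs (pb, qb), (pc, qc), (pd, qd); the coefficients are
  -- fitted to the strings 0 1^b 0^c 1^d with b, c, d ∈ {0, 1}.
  closedForm : (y pb qb pc qc pd qd : Carrier) → Carrier
  closedForm y pb qb pc qc pd qd =
    (y ⊕ ⊝ 1#) ⊗ qb ⊗ qc ⊗ qd ⊕ ⊝ (y ⊗ (pb ⊗ qc ⊗ qd ⊕ qb ⊗ pc ⊗ qd ⊕ qb ⊗ qc ⊗ pd))
    ⊕ 4 · (pb ⊗ pc ⊗ qd) ⊕ 4 · (y ⊗ pb ⊗ pc ⊗ pd)

  -- closedForm at the arguments 1 + cᵢ + kᵢ s, written in terms of e = s and t = y ^ s.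
  affineForm : (y e t : Carrier) (c₁ k₁ c₂ k₂ c₃ k₃ : ℕ) → Carrier
  affineForm y e t c₁ k₁ c₂ k₂ c₃ k₃ =
    closedForm y (φₐ c₁ k₁) (ψₐ (suc c₁) k₁) (φₐ c₂ k₂) (ψₐ (suc c₂) k₂) (φₐ c₃ k₃) (ψₐ (suc c₃) k₃)
    where
    ψₐ φₐ : ℕ → ℕ → Carrier
    ψₐ c k = y ^ c ⊗ t ^ k
    φₐ c k = (suc c · 1# ⊕ k · e) ⊗ ψₐ c k

exprRawRing : ℕ → RawRing _ _
exprRawRing n = record
  { Carrier = Expr Poly n ; _≈_ = _≡_ ; _+_ = Expr._⊕_ ; _*_ = Expr._⊗_ ; -_ = Expr.⊝_
  ; 0# = Expr.Κ 0P ; 1# = Expr.Κ 1P }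

polyRawRing : RawRing _ _
polyRawRing = CommutativeRing.rawRing polyRing

open Forms polyRawRing

-- Seidel characteristic polynomials of binary strings

χ : BinString → Poly
χ w = charPoly (order w) (seidel w)

detℕ : ℕ → (ℕ → ℕ → Poly) → Poly
detℕ n f = det n (λ i j → f (toℕ i) (toℕ j))

symbolAt : BinString → ℕ → Bool
symbolAt []      k       = false
symbolAt (s ∷ w) zero    = s
symbolAt (s ∷ w) (suc k) = symbolAt w k

-- Adjacency of a vertex with symbol s at position i and one with symbol t at
-- position j, given the truth values of i < j and j < i.
adjacentSymbols : Bool → Bool → Bool → Bool → Bool
adjacentSymbols false true  i<j j<i = i<j
adjacentSymbols true  false i<j j<i = j<i
adjacentSymbols _     _     _   _   = false

adjacentℕ : BinString → ℕ → ℕ → Bool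
adjacentℕ w i j = adjacentSymbols (symbolAt w i) (symbolAt w j) (i <ᵇ j) (j <ᵇ i)

charEntry : BinString → ℕ → ℕ → Poly
charEntry w i j =
  if i ≡ᵇ j then varP +P constP (- 0ℤ) else constP (- (if adjacentℕ w i j then -1ℤ else 1ℤ))

≡ᵇ-refl : ∀ n → (n ≡ᵇ n) ≡ true
≡ᵇ-refl zero    = refl
≡ᵇ-refl (suc n) = ≡ᵇ-refl n

≢⇒≡ᵇ-false : ∀ m n → m ≢ n → (m ≡ᵇ n) ≡ false
≢⇒≡ᵇ-false zero    zero    m≢n = ⊥-elim (m≢n refl)
≢⇒≡ᵇ-false zero    (suc n) m≢n = refl
≢⇒≡ᵇ-false (suc m) zero    m≢n = refl
≢⇒≡ᵇ-false (suc m) (suc n) m≢n = ≢⇒≡ᵇ-false m n (m≢n ∘ cong suc)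

lookup≡symbolAt : ∀ (w : BinString) i → lookup w i ≡ symbolAt w (toℕ i)
lookup≡symbolAt (s ∷ w) zero    = refl
lookup≡symbolAt (s ∷ w) (suc i) = lookup≡symbolAt w i

adjacent≡adjacentℕ : ∀ (w : BinString) i j → adjacent w i j ≡ adjacentℕ w (toℕ i) (toℕ j)
adjacent≡adjacentℕ w i j rewrite sym (lookup≡symbolAt w i) | sym (lookup≡symbolAt w j)
  with lookup w i | lookup w j
... | false | false = refl
... | false | true  = refl
... | true  | false = refl
... | true  | true  = refl

seidel-diag : ∀ (w : BinString) i → seidel w i i ≡ 0ℤ
seidel-diag w i with i ≟ i
... | yes _  = refl
... | no i≢i = ⊥-elim (i≢i refl)

seidel-off : ∀ (w : BinString) i j → i ≢ j →
  seidel w i j ≡ (if adjacentℕ w (toℕ i) (toℕ j) then -1ℤ else 1ℤ)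
seidel-off w i j i≢j with i ≟ j
... | yes i≡j = ⊥-elim (i≢j i≡j)
... | no  _   rewrite adjacent≡adjacentℕ w i j = refl

-- Mirrors the local definition of the entries of xI - S in charPoly.
charMatrix : ∀ {n} → Matrix n → Fin n → Fin n → Poly
charMatrix S i j with i ≟ j
... | yes _ = varP +P constP (- S i j)
... | no  _ = constP (- S i j)

charMatrix-seidel : ∀ (w : BinString) i j → charMatrix (seidel w) i j ≡ charEntry w (toℕ i) (toℕ j)
charMatrix-seidel w i j with i ≟ j
... | yes refl rewrite ≡ᵇ-refl (toℕ i) = cong (λ s → varP +P constP (- s)) (seidel-diag w i)
... | no i≢j   rewrite ≢⇒≡ᵇ-false (toℕ i) (toℕ j) (i≢j ∘ toℕ-injective) =
  cong (λ s → constP (- s)) (seidel-off w i j i≢j)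

-- The left-hand side of charEntry≈charMatrix is the local entry function of
-- charPoly, which cannot be named and is found by unification.
mutual
  charPoly≈det-charMatrix : ∀ n (S : Matrix n) → charPoly n S ≈ det n (charMatrix S)
  charPoly≈det-charMatrix n S = det-cong n (charEntry≈charMatrix S)

  charEntry≈charMatrix : ∀ {n} (S : Matrix n) i j → _ ≈ charMatrix S i j
  charEntry≈charMatrix S i j with i ≟ j
  ... | yes _ = ≈-refl
  ... | no  _ = ≈-refl

χ≈detℕ : ∀ w → χ w ≈ detℕ (length w) (charEntry w)
χ≈detℕ w = ≈-trans (charPoly≈det-charMatrix (length w) (seidel w))
                   (det-cong (length w) λ i j → ≈-reflexive (charMatrix-seidel w i j))

detℕ-length : ∀ {m n} f → m ≡ n → detℕ m f ≡ detℕ n f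
detℕ-length f refl = refl

punchInℕ : ℕ → ℕ → ℕ
punchInℕ zero    r       = suc r
punchInℕ (suc i) zero    = zero
punchInℕ (suc i) (suc r) = suc (punchInℕ i r)

toℕ-punchIn : ∀ {n} (i : Fin (suc n)) r → toℕ (punchIn i r) ≡ punchInℕ (toℕ i) (toℕ r)
toℕ-punchIn zero    r       = refl
toℕ-punchIn (suc i) zero    = refl
toℕ-punchIn (suc i) (suc r) = cong suc (toℕ-punchIn i r)

punchInℕ-≡ᵇ : ∀ i r k → (punchInℕ i r ≡ᵇ punchInℕ i k) ≡ (r ≡ᵇ k)
punchInℕ-≡ᵇ zero    r       k       = refl
punchInℕ-≡ᵇ (suc i) zero    zero    = refl
punchInℕ-≡ᵇ (suc i) zero    (suc k) = refl
punchInℕ-≡ᵇ (suc i) (suc r) zero    = refl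
punchInℕ-≡ᵇ (suc i) (suc r) (suc k) = punchInℕ-≡ᵇ i r k

punchInℕ-<ᵇ : ∀ i r k → (punchInℕ i r <ᵇ punchInℕ i k) ≡ (r <ᵇ k)
punchInℕ-<ᵇ zero    r       k       = refl
punchInℕ-<ᵇ (suc i) zero    zero    = refl
punchInℕ-<ᵇ (suc i) zero    (suc k) = refl
punchInℕ-<ᵇ (suc i) (suc r) zero    = refl
punchInℕ-<ᵇ (suc i) (suc r) (suc k) = punchInℕ-<ᵇ i r k

charEntry-punchInℕ : ∀ w w′ i → (∀ r → symbolAt w (punchInℕ i r) ≡ symbolAt w′ r) →
  ∀ r k → charEntry w (punchInℕ i r) (punchInℕ i k) ≡ charEntry w′ r k
charEntry-punchInℕ w w′ i symbols r k
  rewrite punchInℕ-≡ᵇ i r k | punchInℕ-<ᵇ i r k | punchInℕ-<ᵇ i k r | symbols r | symbols k = refl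

symbolAt-delete : ∀ (u : BinString) x v r → symbolAt (u ++ x ∷ v) (punchInℕ (length u) r) ≡ symbolAt (u ++ v) r
symbolAt-delete []      x v r       = refl
symbolAt-delete (s ∷ u) x v zero    = refl
symbolAt-delete (s ∷ u) x v (suc r) = symbolAt-delete u x v r

symbolAt-delete-second : ∀ (u : BinString) x v r →
  symbolAt (u ++ x ∷ x ∷ v) (punchInℕ (suc (length u)) r) ≡ symbolAt (u ++ x ∷ v) r
symbolAt-delete-second []      x v zero    = refl
symbolAt-delete-second []      x v (suc r) = refl
symbolAt-delete-second (s ∷ u) x v zero    = refl
symbolAt-delete-second (s ∷ u) x v (suc r) = symbolAt-delete-second u x v r

symbolAt-middle : ∀ (u : BinString) x v → symbolAt (u ++ x ∷ v) (length u) ≡ x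
symbolAt-middle []      x v = refl
symbolAt-middle (s ∷ u) x v = symbolAt-middle u x v

symbolAt-middle-second : ∀ (u : BinString) x y v → symbolAt (u ++ x ∷ y ∷ v) (suc (length u)) ≡ y
symbolAt-middle-second []      x y v = refl
symbolAt-middle-second (s ∷ u) x y v = symbolAt-middle-second u x y v

<ᵇ-between : ∀ r a → r ≢ a → r ≢ suc a → (r <ᵇ a) ≡ (r <ᵇ suc a)
<ᵇ-between zero    zero    r≢a r≢a+1 = ⊥-elim (r≢a refl)
<ᵇ-between zero    (suc a) r≢a r≢a+1 = refl
<ᵇ-between (suc r) zero    r≢a r≢a+1 = refl
<ᵇ-between (suc r) (suc a) r≢a r≢a+1 = <ᵇ-between r a (r≢a ∘ cong suc) (r≢a+1 ∘ cong suc)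

>ᵇ-between : ∀ r a → r ≢ a → r ≢ suc a → (a <ᵇ r) ≡ (suc a <ᵇ r)
>ᵇ-between zero          zero    r≢a r≢a+1 = ⊥-elim (r≢a refl)
>ᵇ-between zero          (suc a) r≢a r≢a+1 = refl
>ᵇ-between (suc zero)    zero    r≢a r≢a+1 = ⊥-elim (r≢a+1 refl)
>ᵇ-between (suc (suc r)) zero    r≢a r≢a+1 = refl
>ᵇ-between (suc r)       (suc a) r≢a r≢a+1 = >ᵇ-between r a (r≢a ∘ cong suc) (r≢a+1 ∘ cong suc)

adjacentSymbols-same : ∀ s i<j j<i → adjacentSymbols s s i<j j<i ≡ false
adjacentSymbols-same false i<j j<i = refl
adjacentSymbols-same true  i<j j<i = refl

x+1 : Poly
x+1 = varP +P 1P

module _ (u : BinString) (x : Bool) (v : BinString) where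
  private
    w = u ++ x ∷ x ∷ v
    a = length u
    n = length u + length v

    symbol-a : symbolAt w a ≡ x
    symbol-a = symbolAt-middle u x (x ∷ v)

    symbol-a+1 : symbolAt w (suc a) ≡ x
    symbol-a+1 = symbolAt-middle-second u x x v

    same-column : ∀ r → r ≢ a → r ≢ suc a → charEntry w r a ≡ charEntry w r (suc a)
    same-column r r≢a r≢a+1
      rewrite ≢⇒≡ᵇ-false r a r≢a | ≢⇒≡ᵇ-false r (suc a) r≢a+1
            | <ᵇ-between r a r≢a r≢a+1 | >ᵇ-between r a r≢a r≢a+1 | symbol-a | symbol-a+1 = refl

    diag-a : charEntry w a a ≈ x+1 +P charEntry w a (suc a)
    diag-a rewrite ≡ᵇ-refl a | ≢⇒≡ᵇ-false a (suc a) (≢-sym ℕ.1+n≢n) | symbol-a | symbol-a+1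
                 | adjacentSymbols-same x (a <ᵇ suc a) (suc a <ᵇ a) = ≈-refl

    diag-a+1 : charEntry w (suc a) (suc a) ≈ x+1 +P charEntry w (suc a) a
    diag-a+1 rewrite ≡ᵇ-refl a | ≢⇒≡ᵇ-false (suc a) a (≢-sym (≢-sym ℕ.1+n≢n)) | symbol-a | symbol-a+1
                   | adjacentSymbols-same x (suc a <ᵇ a) (a <ᵇ suc a) = ≈-refl

    p : Fin (suc n)
    p = fromℕ< (s≤s (ℕ.m≤m+n (length u) (length v)))

    toℕ-p : toℕ p ≡ a
    toℕ-p = toℕ-fromℕ< (s≤s (ℕ.m≤m+n (length u) (length v)))

    toℕ-inject₁-p : toℕ (inject₁ p) ≡ a
    toℕ-inject₁-p = trans (toℕ-inject₁ p) toℕ-p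

    M : Mat (suc (suc n))
    M i j = charEntry w (toℕ i) (toℕ j)

    twins : Twins x+1 p M
    twins = record { columns = columns ; diagˡ = diagˡ ; diagʳ = diagʳ }
      where
      columns : ∀ r → r ≢ inject₁ p → r ≢ suc p → M r (inject₁ p) ≈ M r (suc p)
      columns r r≢a r≢b rewrite toℕ-inject₁-p | toℕ-p = ≈-reflexive (same-column (toℕ r)
        (λ e → r≢a (toℕ-injective (trans e (sym toℕ-inject₁-p))))
        (λ e → r≢b (toℕ-injective (trans e (cong suc (sym toℕ-p))))))
      diagˡ : M (inject₁ p) (inject₁ p) ≈ x+1 +P M (inject₁ p) (suc p)
      diagˡ rewrite toℕ-inject₁-p | toℕ-p = diag-a
      diagʳ : M (suc p) (suc p) ≈ x+1 +P M (suc p) (inject₁ p)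
      diagʳ rewrite toℕ-inject₁-p | toℕ-p = diag-a+1

    det≈χ : ∀ w′ {m} (N : Mat m) → m ≡ length w′ → (∀ r k → N r k ≡ charEntry w′ (toℕ r) (toℕ k)) → det m N ≈ χ w′
    det≈χ w′ N refl entries = ≈-trans (det-cong (length w′) λ r k → ≈-reflexive (entries r k)) (≈-sym (χ≈detℕ w′))

    length-w : length w ≡ suc (suc n)
    length-w = trans (length-++ u) (trans (ℕ.+-suc a (suc (length v))) (cong suc (ℕ.+-suc a (length v))))

    length-middle : length (u ++ x ∷ v) ≡ suc n
    length-middle = trans (length-++ u) (ℕ.+-suc a (length v))

    delete-a : det (suc n) (minor (inject₁ p) (inject₁ p) M) ≈ χ (u ++ x ∷ v)
    delete-a = det≈χ (u ++ x ∷ v) _ (sym length-middle) entries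
      where
      entries : ∀ r k → M (punchIn (inject₁ p) r) (punchIn (inject₁ p) k) ≡ charEntry (u ++ x ∷ v) (toℕ r) (toℕ k)
      entries r k rewrite toℕ-punchIn (inject₁ p) r | toℕ-punchIn (inject₁ p) k | toℕ-inject₁-p =
        charEntry-punchInℕ w (u ++ x ∷ v) a (symbolAt-delete u x (x ∷ v)) (toℕ r) (toℕ k)

    delete-a+1 : det (suc n) (minor (suc p) (suc p) M) ≈ χ (u ++ x ∷ v)
    delete-a+1 = det≈χ (u ++ x ∷ v) _ (sym length-middle) entries
      where
      entries : ∀ r k → M (punchIn (suc p) r) (punchIn (suc p) k) ≡ charEntry (u ++ x ∷ v) (toℕ r) (toℕ k)
      entries r k rewrite toℕ-punchIn (suc p) r | toℕ-punchIn (suc p) k | toℕ-p =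
        charEntry-punchInℕ w (u ++ x ∷ v) (suc a) (symbolAt-delete-second u x v) (toℕ r) (toℕ k)

    delete-both : det n (minor p p (minor (suc p) (suc p) M)) ≈ χ (u ++ v)
    delete-both = det≈χ (u ++ v) _ (sym (length-++ u)) entries
      where
      entries : ∀ r k → minor p p (minor (suc p) (suc p) M) r k ≡ charEntry (u ++ v) (toℕ r) (toℕ k)
      entries r k
        rewrite toℕ-punchIn (suc p) (punchIn p r) | toℕ-punchIn (suc p) (punchIn p k)
              | toℕ-punchIn p r | toℕ-punchIn p k | toℕ-p =
        trans (charEntry-punchInℕ w (u ++ x ∷ v) (suc a) (symbolAt-delete-second u x v)
                                    (punchInℕ a (toℕ r)) (punchInℕ a (toℕ k)))
                (charEntry-punchInℕ (u ++ x ∷ v) (u ++ v) a (symbolAt-delete u x v) (toℕ r) (toℕ k))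

  χ-twins : χ (u ++ x ∷ x ∷ v) ≈ step x+1 (χ (u ++ x ∷ v)) (χ (u ++ v))
  χ-twins = begin
    χ w
      ≈⟨ χ≈detℕ w ⟩
    detℕ (length w) (charEntry w)
      ≡⟨ detℕ-length (charEntry w) length-w ⟩
    det (suc (suc n)) M
      ≈⟨ det-twins twins ⟩
    x+1 *P det (suc n) (minor (inject₁ p) (inject₁ p) M) +P
      x+1 *P (det (suc n) (minor (suc p) (suc p) M) +P -P (x+1 *P det n (minor p p (minor (suc p) (suc p) M))))
      ≈⟨ +P-cong (*P-congˡ x+1 delete-a) (*P-congˡ x+1 (+P-cong delete-a+1 (-P-cong (*P-congˡ x+1 delete-both)))) ⟩
    step x+1 (χ (u ++ x ∷ v)) (χ (u ++ v))
      ∎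

-- The characteristic polynomial of 0 1^b 0^c 1^d

closedForm-cong : ∀ y {pb pb′ qb qb′ pc pc′ qc qc′ pd pd′ qd qd′} →
  pb ≈ pb′ → qb ≈ qb′ → pc ≈ pc′ → qc ≈ qc′ → pd ≈ pd′ → qd ≈ qd′ →
  closedForm y pb qb pc qc pd qd ≈ closedForm y pb′ qb′ pc′ qc′ pd′ qd′
closedForm-cong y pb≈ qb≈ pc≈ qc≈ pd≈ qd≈ =
  +P-cong (+P-cong (+P-cong (*P-cong (*P-cong (*P-congˡ (y +P -P 1P) qb≈) qc≈) qd≈)
                            (-P-cong (*P-congˡ y (+P-cong (+P-cong (*P-cong (*P-cong pb≈ qc≈) qd≈)
                                                                   (*P-cong (*P-cong qb≈ pc≈) qd≈))
                                                          (*P-cong (*P-cong qb≈ qc≈) pd≈)))))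
                   (×-congʳ 4 (*P-cong (*P-cong pb≈ pc≈) qd≈)))
          (×-congʳ 4 (*P-cong (*P-cong (*P-congˡ y pb≈) pc≈) pd≈))

closedForm-step-b : ∀ y p₁ p₀ q₁ q₀ pc qc pd qd →
  closedForm y (step y p₁ p₀) (step y q₁ q₀) pc qc pd qd ≈
  step y (closedForm y p₁ q₁ pc qc pd qd) (closedForm y p₀ q₀ pc qc pd qd)
closedForm-step-b = solve 9 (λ y p₁ p₀ q₁ q₀ pc qc pd qd →
  E.closedForm y (E.step y p₁ p₀) (E.step y q₁ q₀) pc qc pd qd ⊜
  E.step y (E.closedForm y p₁ q₁ pc qc pd qd) (E.closedForm y p₀ q₀ pc qc pd qd)) ≈-refl
  where module E = Forms (exprRawRing 9)

closedForm-step-c : ∀ y pb qb p₁ p₀ q₁ q₀ pd qd →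
  closedForm y pb qb (step y p₁ p₀) (step y q₁ q₀) pd qd ≈
  step y (closedForm y pb qb p₁ q₁ pd qd) (closedForm y pb qb p₀ q₀ pd qd)
closedForm-step-c = solve 9 (λ y pb qb p₁ p₀ q₁ q₀ pd qd →
  E.closedForm y pb qb (E.step y p₁ p₀) (E.step y q₁ q₀) pd qd ⊜
  E.step y (E.closedForm y pb qb p₁ q₁ pd qd) (E.closedForm y pb qb p₀ q₀ pd qd)) ≈-refl
  where module E = Forms (exprRawRing 9)

closedForm-step-d : ∀ y pb qb pc qc p₁ p₀ q₁ q₀ →
  closedForm y pb qb pc qc (step y p₁ p₀) (step y q₁ q₀) ≈
  step y (closedForm y pb qb pc qc p₁ q₁) (closedForm y pb qb pc qc p₀ q₀)
closedForm-step-d = solve 9 (λ y pb qb pc qc p₁ p₀ q₁ q₀ →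
  E.closedForm y pb qb pc qc (E.step y p₁ p₀) (E.step y q₁ q₀) ⊜
  E.step y (E.closedForm y pb qb pc qc p₁ q₁) (E.closedForm y pb qb pc qc p₀ q₀)) ≈-refl
  where module E = Forms (exprRawRing 9)

StepRecurrent : (ℕ → Poly) → Set
StepRecurrent X = ∀ n → X (suc (suc n)) ≈ step x+1 (X (suc n)) (X n)

step-cong : ∀ y {p p′ q q′} → p ≈ p′ → q ≈ q′ → step y p q ≈ step y p′ q′
step-cong y p≈p′ q≈q′ = +P-cong (*P-congˡ y p≈p′) (*P-congˡ y (+P-cong p≈p′ (-P-cong (*P-congˡ y q≈q′))))

recurrence-unique : ∀ X Y → StepRecurrent X → StepRecurrent Y → X 0 ≈ Y 0 → X 1 ≈ Y 1 → ∀ n → X n ≈ Y n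
recurrence-unique X Y recX recY e₀ e₁ n = proj₁ (consecutive n)
  where
  consecutive : ∀ n → X n ≈ Y n × X (suc n) ≈ Y (suc n)
  consecutive zero    = e₀ , e₁
  consecutive (suc n) with consecutive n
  ... | eₙ , eₙ₊₁ = eₙ₊₁ , ≈-trans (recX n) (≈-trans (step-cong x+1 eₙ₊₁ eₙ) (≈-sym (recY n)))

-- n y^(n-1) and y^n span the solutions of the recurrence.
φ ψ : ℕ → Poly
φ zero    = 0P
φ (suc n) = (suc n · 1P) *P ψ n
ψ n = x+1 ^ n

ψ-recurrent : StepRecurrent ψ
ψ-recurrent n = lemma x+1 (ψ n)
  where
  lemma : ∀ y t → y *P (y *P t) ≈ y *P (y *P t) +P y *P (y *P t +P -P (y *P t))
  lemma = solve-∀ polyACR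

φ-recurrent : StepRecurrent φ
φ-recurrent zero    = lemma x+1
  where
  lemma : ∀ y → (1P +P (1P +P 0P)) *P (y *P 1P) ≈
                y *P ((1P +P 0P) *P 1P) +P y *P ((1P +P 0P) *P 1P +P -P (y *P 0P))
  lemma = solve-∀ polyACR
φ-recurrent (suc n) = lemma x+1 (n · 1P) (ψ n)
  where
  lemma : ∀ y e t → (1P +P (1P +P (1P +P e))) *P (y *P (y *P t)) ≈
                    y *P ((1P +P (1P +P e)) *P (y *P t)) +P y *P ((1P +P (1P +P e)) *P (y *P t) +P -P (y *P ((1P +P e) *P t)))
  lemma = solve-∀ polyACR

F : ℕ → ℕ → ℕ → Poly
F b c d = closedForm x+1 (φ b) (ψ b) (φ c) (ψ c) (φ d) (ψ d)

F-recurrent-b : ∀ c d → StepRecurrent (λ b → F b c d)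
F-recurrent-b c d b =
  ≈-trans (closedForm-cong x+1 (φ-recurrent b) (ψ-recurrent b) (≈-refl {φ c}) (≈-refl {ψ c}) (≈-refl {φ d}) (≈-refl {ψ d}))
          (closedForm-step-b x+1 (φ (suc b)) (φ b) (ψ (suc b)) (ψ b) (φ c) (ψ c) (φ d) (ψ d))

F-recurrent-c : ∀ b d → StepRecurrent (λ c → F b c d)
F-recurrent-c b d c =
  ≈-trans (closedForm-cong x+1 (≈-refl {φ b}) (≈-refl {ψ b}) (φ-recurrent c) (ψ-recurrent c) (≈-refl {φ d}) (≈-refl {ψ d}))
          (closedForm-step-c x+1 (φ b) (ψ b) (φ (suc c)) (φ c) (ψ (suc c)) (ψ c) (φ d) (ψ d))

F-recurrent-d : ∀ b c → StepRecurrent (λ d → F b c d)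
F-recurrent-d b c d =
  ≈-trans (closedForm-cong x+1 (≈-refl {φ b}) (≈-refl {ψ b}) (≈-refl {φ c}) (≈-refl {ψ c}) (φ-recurrent d) (ψ-recurrent d))
          (closedForm-step-d x+1 (φ b) (ψ b) (φ c) (ψ c) (φ (suc d)) (φ d) (ψ (suc d)) (ψ d))

blocks : ℕ → ℕ → ℕ → BinString
blocks b c d = zeros 1 ++ ones b ++ zeros c ++ ones d

χ-recurrent-b : ∀ c d → StepRecurrent (λ b → χ (blocks b c d))
χ-recurrent-b c d b = χ-twins (false ∷ []) true (ones b ++ zeros c ++ ones d)

χ-recurrent-c : ∀ b d → StepRecurrent (λ c → χ (blocks b c d))
χ-recurrent-c b d c = χ-twins (false ∷ ones b) false (zeros c ++ ones d)

blocks-last : ∀ b c d → blocks b c d ≡ (false ∷ ones b ++ zeros c) ++ ones d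
blocks-last b c d = cong (false ∷_) (sym (++-assoc (ones b) (zeros c) (ones d)))

χ-recurrent-d : ∀ b c → StepRecurrent (λ d → χ (blocks b c d))
χ-recurrent-d b c d =
  ≈-trans (≈-reflexive (cong χ (blocks-last b c (suc (suc d)))))
    (≈-trans (χ-twins (false ∷ ones b ++ zeros c) true (ones d))
             (step-cong x+1 (≈-reflexive (cong χ (sym (blocks-last b c (suc d)))))
                            (≈-reflexive (cong χ (sym (blocks-last b c d))))))

χ≈F : ∀ b c d → χ (blocks b c d) ≈ F b c d
χ≈F b c d =
  extend-d (extend-c 0 (extend-b 0 0 (computed 0 0 0) (computed 1 0 0)) (extend-b 1 0 (computed 0 1 0) (computed 1 1 0)))
           (extend-c 1 (extend-b 0 1 (computed 0 0 1) (computed 1 0 1)) (extend-b 1 1 (computed 0 1 1) (computed 1 1 1)))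
  where
  computed : ∀ b c d → From-just (≈-test (χ (blocks b c d)) (F b c d))
  computed b c d = from-just (≈-test (χ (blocks b c d)) (F b c d))
  extend-b : ∀ c d → χ (blocks 0 c d) ≈ F 0 c d → χ (blocks 1 c d) ≈ F 1 c d → χ (blocks b c d) ≈ F b c d
  extend-b c d e₀ e₁ = recurrence-unique (λ b → χ (blocks b c d)) (λ b → F b c d) (χ-recurrent-b c d) (F-recurrent-b c d) e₀ e₁ b
  extend-c : ∀ d → χ (blocks b 0 d) ≈ F b 0 d → χ (blocks b 1 d) ≈ F b 1 d → χ (blocks b c d) ≈ F b c d
  extend-c d e₀ e₁ = recurrence-unique (λ c → χ (blocks b c d)) (λ c → F b c d) (χ-recurrent-c b d) (F-recurrent-c b d) e₀ e₁ c
  extend-d : χ (blocks b c 0) ≈ F b c 0 → χ (blocks b c 1) ≈ F b c 1 → χ (blocks b c d) ≈ F b c d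
  extend-d e₀ e₁ = recurrence-unique (λ d → χ (blocks b c d)) (λ d → F b c d) (χ-recurrent-d b c) (F-recurrent-d b c) e₀ e₁ d

-- The cospectral family

ψ-affine : ∀ c k s → ψ (c + k * s) ≈ x+1 ^ c *P (x+1 ^ s) ^ k
ψ-affine c k s = ≈-trans (^-homo-* x+1 c (k * s)) (*P-congˡ (x+1 ^ c)
  (≈-trans (≈-reflexive (cong (x+1 ^_) (ℕ.*-comm k s))) (≈-sym (^-assocʳ x+1 s k))))

φ-affine : ∀ c k s → φ (suc c + k * s) ≈ (suc c · 1P +P k · (s · 1P)) *P (x+1 ^ c *P (x+1 ^ s) ^ k)
φ-affine c k s = *P-cong (≈-trans (×-homo-+ 1P (suc c) (k * s)) (+P-congˡ (suc c · 1P) (≈-sym (×-assocˡ 1P k s))))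
                         (ψ-affine c k s)

F-affine : ∀ s c₁ k₁ c₂ k₂ c₃ k₃ →
  F (suc c₁ + k₁ * s) (suc c₂ + k₂ * s) (suc c₃ + k₃ * s) ≈ affineForm x+1 (s · 1P) (x+1 ^ s) c₁ k₁ c₂ k₂ c₃ k₃
F-affine s c₁ k₁ c₂ k₂ c₃ k₃ =
  closedForm-cong x+1 (φ-affine c₁ k₁ s) (ψ-affine (suc c₁) k₁ s) (φ-affine c₂ k₂ s) (ψ-affine (suc c₂) k₂ s)
                      (φ-affine c₃ k₃ s) (ψ-affine (suc c₃) k₃ s)

affineForm-identity : ∀ y e t → affineForm y e t 2 3 2 3 6 8 ≈ affineForm y e t 5 6 5 6 0 2
affineForm-identity = solve 3 (λ y e t → E.affineForm y e t 2 3 2 3 6 8 ⊜ E.affineForm y e t 5 6 5 6 0 2) ≈-refl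
  where module E = Forms (exprRawRing 3)

cospectral-family : ∀ s → let r = 1 + 2 * s ; m = 3 + 3 * s in
  χ (blocks m m (2 * m + r)) ≈ χ (blocks (2 * m) (2 * m) r)
cospectral-family s = begin
  χ (blocks (3 + 3 * s) (3 + 3 * s) (2 * (3 + 3 * s) + (1 + 2 * s)))
    ≈⟨ χ≈F (3 + 3 * s) (3 + 3 * s) (2 * (3 + 3 * s) + (1 + 2 * s)) ⟩
  F (3 + 3 * s) (3 + 3 * s) (2 * (3 + 3 * s) + (1 + 2 * s))
    ≡⟨ cong (F (3 + 3 * s) (3 + 3 * s)) (2[3+3s]+[1+2s] s) ⟩
  F (3 + 3 * s) (3 + 3 * s) (7 + 8 * s)
    ≈⟨ F-affine s 2 3 2 3 6 8 ⟩
  affineForm x+1 (s · 1P) (x+1 ^ s) 2 3 2 3 6 8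
    ≈⟨ affineForm-identity x+1 (s · 1P) (x+1 ^ s) ⟩
  affineForm x+1 (s · 1P) (x+1 ^ s) 5 6 5 6 0 2
    ≈⟨ F-affine s 5 6 5 6 0 2 ⟨
  F (6 + 6 * s) (6 + 6 * s) (1 + 2 * s)
    ≡⟨ cong (λ b → F b b (1 + 2 * s)) (2[3+3s] s) ⟨
  F (2 * (3 + 3 * s)) (2 * (3 + 3 * s)) (1 + 2 * s)
    ≈⟨ χ≈F (2 * (3 + 3 * s)) (2 * (3 + 3 * s)) (1 + 2 * s) ⟨
  χ (blocks (2 * (3 + 3 * s)) (2 * (3 + 3 * s)) (1 + 2 * s))
    ∎
  where
  2[3+3s]+[1+2s] : ∀ s → 2 * (3 + 3 * s) + (1 + 2 * s) ≡ 7 + 8 * s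
  2[3+3s]+[1+2s] = NatSolver.solve-∀
  2[3+3s] : ∀ s → 2 * (3 + 3 * s) ≡ 6 + 6 * s
  2[3+3s] = NatSolver.solve-∀

parametrise : ∀ r m → r % 2 ≡ 1 → 2 * m ≡ 3 * (r + 1) → ∃[ s ] r ≡ 1 + 2 * s × m ≡ 3 + 3 * s
parametrise r m r-odd 2m≡3[r+1] = s , r≡1+2s , ℕ.*-cancelˡ-≡ m (3 + 3 * s) 2 2m≡2[3+3s]
  where
  s = r / 2
  r≡1+2s : r ≡ 1 + 2 * s
  r≡1+2s = trans (m≡m%n+[m/n]*n r 2) (cong₂ _+_ r-odd (ℕ.*-comm s 2))
  2m≡2[3+3s] : 2 * m ≡ 2 * (3 + 3 * s)
  2m≡2[3+3s] = trans 2m≡3[r+1] (trans (cong (λ r → 3 * (r + 1)) r≡1+2s) (3[2+2s]≡2[3+3s] s))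
    where
    3[2+2s]≡2[3+3s] : ∀ s → 3 * ((1 + 2 * s) + 1) ≡ 2 * (3 + 3 * s)
    3[2+2s]≡2[3+3s] = NatSolver.solve-∀

mainTheorem2 : (r m : ℕ) → r % 2 ≡ 1 → 2 * m ≡ 3 * (r + 1) →
    SeidelCospectral (zeros 1 ++ ones m ++ zeros m ++ ones (2 * m + r))
                     (zeros 1 ++ ones (2 * m) ++ zeros (2 * m) ++ ones r)
mainTheorem2 r m r-odd 2m≡3[r+1] with parametrise r m r-odd 2m≡3[r+1]
... | s , refl , refl = coeff-≡ (cospectral-family s)
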